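{- Let $\gamma/\lambda$ and $\gamma'/\lambda'$ be skew shapes with $\gamma/\lambda\subseteq\gamma'/\lambda'$ (as sets of cells). Then $\uparrow_\leftarrow(\gamma/\lambda)\subseteq\uparrow_\leftarrow(\gamma'/\lambda')$, and hence $\uparrow_\leftarrow(\gamma/\lambda)\le_{GDom}\uparrow_\leftarrow(\gamma'/\lambda')$.
   Context: For partitions $\lambda\subseteq\gamma$ (with $\lambda$ padded by zeros), the skew shape $\gamma/\lambda$ is the set of cells $(i,j)$ (row $i$ from the top, column $j$ from the left) with $\lambda_i<j\le\gamma_i$. The left-top standardization $\uparrow_\leftarrow(\gamma/\lambda)$ is the partition $(r_1,r_2,\ldots)$ obtained by listing the numbers of cells in the rows of $\gamma/\lambda$ in non-increasing order (zero entries discarded). For partitions, $\alpha\subseteq\beta$ means $\alpha_i\le\beta_i$ for all $i$. Generalized dominance order: for a partition $\alpha=(\alpha_1,\ldots,\alpha_k)$ of $n$ and a partition $\beta=(\beta_1,\ldots,\beta_l)$ of $m$ with $n\le m$, write $\alpha\le_{GDom}\beta$ if $\alpha_1+\cdots+\alpha_i\le\beta_1+\cdots+\beta_i$ for all $1\le i\le\min\{k,l\}$. -}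

module Defs where

open import Data.Nat using (ℕ; zero; suc; _∸_; _≤_; _<_; _≤ᵇ_)
open import Data.Nat.Base using (_⊓_)
open import Data.Bool using (if_then_else_)
open import Data.List using (List; []; _∷_; take; length)
open import Data.Nat.ListAction using (sum)
open import Data.List.Relation.Unary.All using (All)
open import Data.List.Relation.Unary.Linked using (Linked)
open import Data.Product using (_×_)

IsPartition : List ℕ → Set
IsPartition xs = Linked (λ a b → b ≤ a) xs × All (λ x → 0 < x) xs

part : List ℕ → ℕ → ℕ
part []       _       = 0
part (x ∷ xs) zero    = x
part (x ∷ xs) (suc i) = part xs i

_⊆ₚ_ : List ℕ → List ℕ → Set
α ⊆ₚ β = ∀ i → part α i ≤ part β i

-- Cell (i , j) (row i, 0-based; column j, 1-based) lies in the skew shape γ/λ.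
InSkew : (γ μ : List ℕ) → ℕ → ℕ → Set
InSkew γ μ i j = part μ i < j × j ≤ part γ i

_⊆skew_ : (List ℕ × List ℕ) → (List ℕ × List ℕ) → Set
(γ Data.Product., μ) ⊆skew (γ' Data.Product., μ') =
  ∀ i j → InSkew γ μ i j → InSkew γ' μ' i j

rowLengths : List ℕ → List ℕ → List ℕ
rowLengths []       _        = []
rowLengths gs       []       = gs
rowLengths (g ∷ gs) (l ∷ ls) = (g ∸ l) ∷ rowLengths gs ls

dropZeros : List ℕ → List ℕ
dropZeros []            = []
dropZeros (zero  ∷ xs)  = dropZeros xs
dropZeros (suc x ∷ xs)  = suc x ∷ dropZeros xs

insertDesc : ℕ → List ℕ → List ℕ
insertDesc x []       = x ∷ []
insertDesc x (y ∷ ys) = if y ≤ᵇ x then x ∷ y ∷ ys else y ∷ insertDesc x ys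

sortDesc : List ℕ → List ℕ
sortDesc []       = []
sortDesc (x ∷ xs) = insertDesc x (sortDesc xs)

-- Left-top standardization ↑←(γ/λ): row lengths sorted non-increasingly, zeros discarded.
standardize : List ℕ → List ℕ → List ℕ
standardize γ μ = sortDesc (dropZeros (rowLengths γ μ))

_≤GDom_ : List ℕ → List ℕ → Set
α ≤GDom β = sum α ≤ sum β ×
  (∀ i → 1 ≤ i → i ≤ length α ⊓ length β → sum (take i α) ≤ sum (take i β))

{-# OPTIONS --safe #-}
-- A row of γ/λ that contains a cell is, by the inclusion of cells, no longer than the
-- same row of γ'/λ', so the row lengths are dominated entrywise. Entrywise domination
-- survives sorting: the k-th largest entry of a list is at least v exactly when more
-- than k entries are at least v, and these counts are monotone, permutation invariant
-- and blind to zeros. Entrywise domination of the sorted lists then bounds every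
-- partial sum, which is the generalized dominance.
module Submission where

open import Defs
open import Data.Nat using (ℕ; zero; suc; _∸_; _≤_; _<_; _≥_; _≰_; _≤ᵇ_; z≤n; s≤s; s≤s⁻¹; _≤?_; _<?_)
open import Data.Nat.Properties
open import Data.Bool using (true; false)
open import Data.Empty using (⊥-elim)
open import Data.List using (List; []; _∷_; take; length; filter)
open import Data.List.Properties using (filter-accept; filter-reject; filter-none; take-[])
open import Data.Nat.ListAction using (sum)
open import Data.List.Relation.Unary.All as All using (All; []; _∷_)
open import Data.List.Relation.Unary.AllPairs using (AllPairs; []; _∷_)
open import Data.List.Relation.Binary.Permutation.Propositional using (_↭_; ↭-refl; ↭-sym; ↭-prep; ↭-swap; ↭-trans)
open import Data.List.Relation.Binary.Permutation.Propositional.Properties using (↭-length; filter-↭; All-resp-↭)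
open import Data.Product using (_×_; _,_)
open import Relation.Binary.PropositionalEquality using (_≡_; refl; sym; trans; cong; subst₂)
open import Relation.Nullary using (yes; no)
open import Relation.Nullary.Reflects using (ofʸ; ofⁿ)

Descending : List ℕ → Set
Descending = AllPairs _≥_

count≥ : ℕ → List ℕ → ℕ
count≥ v xs = length (filter (v ≤?_) xs)

insertDesc-↭ : ∀ x xs → insertDesc x xs ↭ x ∷ xs
insertDesc-↭ x [] = ↭-refl
insertDesc-↭ x (y ∷ ys) with y ≤ᵇ x
... | true  = ↭-refl
... | false = ↭-trans (↭-prep y (insertDesc-↭ x ys)) (↭-swap y x ↭-refl)

sortDesc-↭ : ∀ xs → sortDesc xs ↭ xs
sortDesc-↭ []       = ↭-refl
sortDesc-↭ (x ∷ xs) = ↭-trans (insertDesc-↭ x (sortDesc xs)) (↭-prep x (sortDesc-↭ xs))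

All≥-mono : ∀ {a b} xs → a ≤ b → All (a ≥_) xs → All (b ≥_) xs
All≥-mono []       a≤b []         = []
All≥-mono (_ ∷ xs) a≤b (p ∷ ps) = ≤-trans p a≤b ∷ All≥-mono xs a≤b ps

insertDesc-descending : ∀ x xs → Descending xs → Descending (insertDesc x xs)
insertDesc-descending x [] [] = [] ∷ []
insertDesc-descending x (y ∷ ys) (y≥ys ∷ ys↓) with y ≤ᵇ x | ≤ᵇ-reflects-≤ y x
... | true  | ofʸ y≤x = (y≤x ∷ All≥-mono ys y≤x y≥ys) ∷ y≥ys ∷ ys↓
... | false | ofⁿ y≰x =
  All-resp-↭ (↭-sym (insertDesc-↭ x ys)) (≰⇒≥ y≰x ∷ y≥ys) ∷ insertDesc-descending x ys ys↓

sortDesc-descending : ∀ xs → Descending (sortDesc xs)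
sortDesc-descending []       = []
sortDesc-descending (x ∷ xs) = insertDesc-descending x (sortDesc xs) (sortDesc-descending xs)

count≥-resp-↭ : ∀ v {xs ys} → xs ↭ ys → count≥ v xs ≡ count≥ v ys
count≥-resp-↭ v xs↭ys = ↭-length (filter-↭ (v ≤?_) xs↭ys)

filter-dropZeros : ∀ {v} → 1 ≤ v → ∀ xs → filter (v ≤?_) (dropZeros xs) ≡ filter (v ≤?_) xs
filter-dropZeros 1≤v [] = refl
filter-dropZeros {v} 1≤v (zero ∷ xs) =
  trans (filter-dropZeros 1≤v xs) (sym (filter-reject (v ≤?_) (<⇒≱ 1≤v)))
filter-dropZeros {v} 1≤v (suc x ∷ xs) with v ≤? suc x
... | yes v≤x = trans (filter-accept (v ≤?_) v≤x)
                  (trans (cong (suc x ∷_) (filter-dropZeros 1≤v xs)) (sym (filter-accept (v ≤?_) v≤x)))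
... | no  v≰x = trans (filter-reject (v ≤?_) v≰x)
                  (trans (filter-dropZeros 1≤v xs) (sym (filter-reject (v ≤?_) v≰x)))

count≥-sortDesc-dropZeros : ∀ {v} → 1 ≤ v → ∀ xs → count≥ v (sortDesc (dropZeros xs)) ≡ count≥ v xs
count≥-sortDesc-dropZeros {v} 1≤v xs =
  trans (count≥-resp-↭ v (sortDesc-↭ (dropZeros xs))) (cong length (filter-dropZeros 1≤v xs))

count≥-accept : ∀ {v x} xs → v ≤ x → count≥ v (x ∷ xs) ≡ suc (count≥ v xs)
count≥-accept {v} xs v≤x = cong length (filter-accept (v ≤?_) v≤x)

count≥-reject : ∀ {v x} xs → v ≰ x → count≥ v (x ∷ xs) ≡ count≥ v xs
count≥-reject {v} xs v≰x = cong length (filter-reject (v ≤?_) v≰x)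

count≥-mono : ∀ {v} → 1 ≤ v → ∀ xs ys → xs ⊆ₚ ys → count≥ v xs ≤ count≥ v ys
count≥-mono 1≤v [] ys xs⊆ys = z≤n
count≥-mono {v} 1≤v (x ∷ xs) [] xs⊆ys with v ≤? x
... | yes v≤x = ⊥-elim (<⇒≱ 1≤v (≤-trans v≤x (xs⊆ys 0)))
... | no  v≰x rewrite count≥-reject xs v≰x = count≥-mono 1≤v xs [] (λ i → xs⊆ys (suc i))
count≥-mono {v} 1≤v (x ∷ xs) (y ∷ ys) xs⊆ys
  with v ≤? x | v ≤? y | count≥-mono 1≤v xs ys (λ i → xs⊆ys (suc i))
... | yes v≤x | yes v≤y | ih rewrite count≥-accept xs v≤x | count≥-accept ys v≤y = s≤s ih
... | yes v≤x | no  v≰y | _  = ⊥-elim (v≰y (≤-trans v≤x (xs⊆ys 0)))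
... | no  v≰x | yes v≤y | ih rewrite count≥-reject xs v≰x | count≥-accept ys v≤y = m≤n⇒m≤1+n ih
... | no  v≰x | no  v≰y | ih rewrite count≥-reject xs v≰x | count≥-reject ys v≰y = ih

part-≤ : ∀ {a} xs k → All (a ≥_) xs → part xs k ≤ a
part-≤ []       k       []       = z≤n
part-≤ (x ∷ xs) zero    (p ∷ _)  = p
part-≤ (x ∷ xs) (suc k) (_ ∷ ps) = part-≤ xs k ps

≤part⇒<count≥ : ∀ {v} → 1 ≤ v → ∀ xs k → Descending xs → v ≤ part xs k → k < count≥ v xs
≤part⇒<count≥ 1≤v [] k [] v≤0 = ⊥-elim (<⇒≱ 1≤v v≤0)
≤part⇒<count≥ 1≤v (x ∷ xs) zero _ v≤x rewrite count≥-accept xs v≤x = s≤s z≤n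
≤part⇒<count≥ 1≤v (x ∷ xs) (suc k) (x≥xs ∷ xs↓) v≤xs[k]
  rewrite count≥-accept xs (≤-trans v≤xs[k] (part-≤ xs k x≥xs)) =
  s≤s (≤part⇒<count≥ 1≤v xs k xs↓ v≤xs[k])

part<⇒count≥≤ : ∀ {v} xs k → Descending xs → part xs k < v → count≥ v xs ≤ k
part<⇒count≥≤ [] k [] _ = z≤n
part<⇒count≥≤ {v} (x ∷ xs) zero (x≥xs ∷ _) x<v =
  ≤-reflexive (cong length (filter-none (v ≤?_) (<⇒≱ x<v ∷ All.map below x≥xs)))
  where
  below : ∀ {y} → x ≥ y → v ≰ y
  below y≤x = <⇒≱ (≤-<-trans y≤x x<v)
part<⇒count≥≤ {v} (x ∷ xs) (suc k) (_ ∷ xs↓) xs[k]<v with v ≤? x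
... | yes v≤x rewrite count≥-accept xs v≤x = s≤s (part<⇒count≥≤ xs k xs↓ xs[k]<v)
... | no  v≰x rewrite count≥-reject xs v≰x = m≤n⇒m≤1+n (part<⇒count≥≤ xs k xs↓ xs[k]<v)

descending-count≥⇒⊆ₚ : ∀ xs ys → Descending xs → Descending ys →
  (∀ v → 1 ≤ v → count≥ v xs ≤ count≥ v ys) → xs ⊆ₚ ys
descending-count≥⇒⊆ₚ xs ys xs↓ ys↓ count≤ k = ≮⇒≥ λ ys[k]<xs[k] →
  let 1≤v = ≤-trans (s≤s z≤n) ys[k]<xs[k] in
  <-irrefl refl (begin-strict
    k                       <⟨ ≤part⇒<count≥ 1≤v xs k xs↓ ≤-refl ⟩
    count≥ (part xs k) xs   ≤⟨ count≤ (part xs k) 1≤v ⟩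
    count≥ (part xs k) ys   ≤⟨ part<⇒count≥≤ ys k ys↓ ys[k]<xs[k] ⟩
    k                       ∎)
  where open ≤-Reasoning

sortDesc-dropZeros-mono : ∀ xs ys → xs ⊆ₚ ys → sortDesc (dropZeros xs) ⊆ₚ sortDesc (dropZeros ys)
sortDesc-dropZeros-mono xs ys xs⊆ys =
  descending-count≥⇒⊆ₚ _ _ (sortDesc-descending (dropZeros xs)) (sortDesc-descending (dropZeros ys))
    λ v 1≤v → subst₂ _≤_ (sym (count≥-sortDesc-dropZeros 1≤v xs)) (sym (count≥-sortDesc-dropZeros 1≤v ys))
                (count≥-mono 1≤v xs ys xs⊆ys)

part-rowLengths : ∀ γ μ i → part (rowLengths γ μ) i ≡ part γ i ∸ part μ i
part-rowLengths []       μ        i       = sym (0∸n≡0 (part μ i))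
part-rowLengths (g ∷ gs) []       zero    = refl
part-rowLengths (g ∷ gs) []       (suc i) = refl
part-rowLengths (g ∷ gs) (l ∷ ls) zero    = refl
part-rowLengths (g ∷ gs) (l ∷ ls) (suc i) = part-rowLengths gs ls i

-- A nonempty row i of γ/μ contains the cells (i, μ_i + 1) and (i, γ_i), so the
-- inclusion of cells forces μ'_i ≤ μ_i and γ_i ≤ γ'_i.
rowLengths-mono : ∀ γ μ γ' μ' → (γ , μ) ⊆skew (γ' , μ') → rowLengths γ μ ⊆ₚ rowLengths γ' μ'
rowLengths-mono γ μ γ' μ' cells⊆ i
  rewrite part-rowLengths γ μ i | part-rowLengths γ' μ' i with part μ i <? part γ i
... | no  μᵢ≮γᵢ rewrite m≤n⇒m∸n≡0 (≮⇒≥ μᵢ≮γᵢ) = z≤n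
... | yes μᵢ<γᵢ =
  let (_ , γᵢ≤γ'ᵢ) = cells⊆ i (part γ i) (μᵢ<γᵢ , ≤-refl)
      (μ'ᵢ<μᵢ+1 , _) = cells⊆ i (suc (part μ i)) (≤-refl , μᵢ<γᵢ)
  in ∸-mono γᵢ≤γ'ᵢ (s≤s⁻¹ μ'ᵢ<μᵢ+1)

sum-mono-⊆ₚ : ∀ α β → α ⊆ₚ β → sum α ≤ sum β
sum-mono-⊆ₚ []      β       α⊆β = z≤n
sum-mono-⊆ₚ (a ∷ α) []      α⊆β = +-mono-≤ (α⊆β 0) (sum-mono-⊆ₚ α [] (λ i → α⊆β (suc i)))
sum-mono-⊆ₚ (a ∷ α) (b ∷ β) α⊆β = +-mono-≤ (α⊆β 0) (sum-mono-⊆ₚ α β (λ i → α⊆β (suc i)))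

take-mono-⊆ₚ : ∀ n α β → α ⊆ₚ β → take n α ⊆ₚ take n β
take-mono-⊆ₚ zero    α       β       α⊆β k       = z≤n
take-mono-⊆ₚ (suc n) []      β       α⊆β k       = z≤n
take-mono-⊆ₚ (suc n) (a ∷ α) []      α⊆β zero    = α⊆β 0
take-mono-⊆ₚ (suc n) (a ∷ α) []      α⊆β (suc k)
  with take-mono-⊆ₚ n α [] (λ i → α⊆β (suc i)) k
... | bound rewrite take-[] {A = ℕ} n = bound
take-mono-⊆ₚ (suc n) (a ∷ α) (b ∷ β) α⊆β zero    = α⊆β 0
take-mono-⊆ₚ (suc n) (a ∷ α) (b ∷ β) α⊆β (suc k) = take-mono-⊆ₚ n α β (λ i → α⊆β (suc i)) k

⊆ₚ⇒≤GDom : ∀ α β → α ⊆ₚ β → α ≤GDom β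
⊆ₚ⇒≤GDom α β α⊆β =
  sum-mono-⊆ₚ α β α⊆β , λ i _ _ → sum-mono-⊆ₚ (take i α) (take i β) (take-mono-⊆ₚ i α β α⊆β)

lemma3p1 : (γ μ γ' μ' : List ℕ) →
    IsPartition γ → IsPartition μ → μ ⊆ₚ γ →
    IsPartition γ' → IsPartition μ' → μ' ⊆ₚ γ' →
    (γ , μ) ⊆skew (γ' , μ') →
    (standardize γ μ ⊆ₚ standardize γ' μ')
      × (standardize γ μ ≤GDom standardize γ' μ')
lemma3p1 γ μ γ' μ' _ _ _ _ _ _ cells⊆ = standardize⊆ , ⊆ₚ⇒≤GDom _ _ standardize⊆
  where
  standardize⊆ : standardize γ μ ⊆ₚ standardize γ' μ'
  standardize⊆ =
    sortDesc-dropZeros-mono (rowLengths γ μ) (rowLengths γ' μ') (rowLengths-mono γ μ γ' μ' cells⊆)
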